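{- Let $G$ be a directed graph and let $\bar b_1,\bar b_2,\bar c_1,\bar c_2$ be nonempty tuples in $L(G)$ such that the concatenations $\bar b_1,\bar b_2$ and $\bar c_1,\bar c_2$ are increasing sequences, $(L(G),\bar b_1)\sim^\gamma(L(G),\bar c_1)$ and $(L(G),\bar b_2)\sim^\gamma(L(G),\bar c_2)$. Suppose there is an element of length $2$ between the last element of $\bar b_1$ and the first element of $\bar b_2$, and an element of length $2$ between the last element of $\bar c_1$ and the first element of $\bar c_2$. Then $(L(G),\bar b_1,\bar b_2)\sim^\gamma(L(G),\bar c_1,\bar c_2)$.
   Context: A directed graph is $G=(V,E)$ with $E$ binary and $V\subseteq\omega$. Fix an effective partition $(A_n)_{n\in\omega}$ of $\mathbb{Q}$ into pairwise disjoint dense sets, and an effective list $(t_m)_{1\le m<\omega}$ of all atomic types in $\{E\}$ of tuples of distinct elements, with $t_1$ the type of the empty tuple, then types of single elements, then of pairs, then triples, etc. $L(G)$ is the set of finite sequences of rationals $r_0q_1r_1\ldots r_{n-1}q_nr_nk$ ($n\ge0$) with $r_i\in A_0$ ($i<n$), $r_n\in A_1$, distinct $a_1,\dots,a_n\in V$ with $q_i\in A_{a_i}$ and $(a_1,\dots,a_n)$ realizing $t_m$ in $G$, and $k\in\omega$, $k<m$; ordered lexicographically. The length of an element is its length as a finite sequence. Back-and-forth relations: $(\mathcal{A},\bar a)\sim^0(\mathcal{B},\bar b)$ if $\bar a,\bar b$ satisfy the same atomic formulas; for $\gamma>0$, $(\mathcal{A},\bar a)\sim^\gamma(\mathcal{B},\bar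 b)$ if for all $\beta<\gamma$, every $\bar c$ in $\mathcal{A}$ has some $\bar d$ in $\mathcal{B}$ with $(\mathcal{A},\bar a,\bar c)\sim^\beta(\mathcal{B},\bar b,\bar d)$ and vice versa. -}

module Defs where

open import Level using (0ℓ)
open import Data.Nat using (ℕ; zero; suc; _≤_; _<_)
open import Data.Bool using (Bool)
open import Data.Integer using (+_)
open import Data.Rational as Q using (ℚ)
open import Data.Fin using (Fin)
open import Data.Vec using (Vec; []; _∷_; lookup; tabulate; _++_)
open import Data.List as List using (List; length)
open import Data.List.Relation.Binary.Lex.Strict using (Lex-<)
open import Data.Product using (Σ; ∃; ∃-syntax; _×_; _,_)
open import Relation.Binary using (Rel; IsStrictTotalOrder)
open import Relation.Binary.PropositionalEquality using (_≡_)
open import Relation.Nullary using (¬_)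
open import Induction.WellFounded using (Acc; acc; WellFounded)
open import Function.Definitions using (Injective)
open import Function.Bundles using (_⇔_)

record DiGraph : Set where
  field
    V : ℕ → Bool
    E : ℕ → ℕ → Bool

-- Atomic types in {E} of n-tuples of distinct elements: determined by
-- the truth values of E(x_i, x_j) for all i, j < n.

AtType : Set
AtType = Σ ℕ λ n → Vec (Vec Bool n) n

arity : AtType → ℕ
arity (n , _) = n

atType : DiGraph → {n : ℕ} → Vec ℕ n → AtType
atType G {n} a = n , tabulate (λ i → tabulate (λ j → DiGraph.E G (lookup a i) (lookup a j)))

-- Fixed data: an (effective) partition (A_n) of ℚ into pairwise disjoint
-- dense sets, given as the map  q ↦ the unique n with q ∈ A_n,
-- and an (effective) list (t_m)_{1 ≤ m} of all atomic types, without
-- repetitions, ordered by the length of the tuples.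
-- We write  enum j  for  t_{j+1}.

record Setting : Set where
  field
    part       : ℚ → ℕ
    part-dense : ∀ (n : ℕ) (p q : ℚ) → p Q.< q →
                 ∃[ r ] (p Q.< r × r Q.< q × part r ≡ n)
    enum       : ℕ → AtType
    enum-inj   : Injective _≡_ _≡_ enum
    enum-surj  : ∀ (τ : AtType) → ∃[ j ] (enum j ≡ τ)
    enum-mono  : ∀ {i j : ℕ} → i ≤ j → arity (enum i) ≤ arity (enum j)

weave : {n : ℕ} → Vec ℚ (suc n) → Vec ℚ n → List ℚ
weave {zero}  (r ∷ [])  []       = r List.∷ List.[]
weave {suc n} (r ∷ rs)  (q ∷ qs) = r List.∷ q List.∷ weave rs qs

ℕ→ℚ : ℕ → ℚ
ℕ→ℚ k = (+ k) Q./ 1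

module _ (S : Setting) (G : DiGraph) where
  open Setting S
  open DiGraph G

  InL : List ℚ → Set
  InL xs =
    Σ ℕ λ n → Σ (Vec ℚ (suc n)) λ r → Σ (Vec ℚ n) λ q →
    Σ (Vec ℕ n) λ a → Σ ℕ λ k → Σ ℕ λ j →
      (xs ≡ weave r q List.++ (ℕ→ℚ k List.∷ List.[]))
    × (∀ (i : Fin n) → part (lookup r (Data.Fin.inject₁ i)) ≡ 0)
    × (part (lookup r (Data.Fin.fromℕ n)) ≡ 1)
    × Injective _≡_ _≡_ (lookup a)
    × (∀ (i : Fin n) → V (lookup a i) ≡ Bool.true)
    × (∀ (i : Fin n) → part (lookup q i) ≡ lookup a i)
    × (enum j ≡ atType G a)          -- (a₁,…,a_n) realizes t_{j+1}
    × (k < suc j)                    -- k < m where m = j+1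

  LG : Set
  LG = Σ (List ℚ) InL

  seq : LG → List ℚ
  seq (xs , _) = xs

  len : LG → ℕ
  len x = length (seq x)

  _≺_ : Rel LG 0ℓ
  x ≺ y = Lex-< _≡_ Q._<_ (seq x) (seq y)

  _≈_ : Rel LG 0ℓ
  x ≈ y = seq x ≡ seq y

  -- same atomic formulas (language {<}, with equality)
  SameAtomic : {n : ℕ} → Vec LG n → Vec LG n → Set
  SameAtomic {n} a b = ∀ (i j : Fin n) →
      (lookup a i ≺ lookup a j ⇔ lookup b i ≺ lookup b j)
    × (lookup a i ≈ lookup a j ⇔ lookup b i ≈ lookup b j)

  Increasing : {n : ℕ} → Vec LG n → Set
  Increasing {n} a = ∀ (i j : Fin n) → i Data.Fin.< j → lookup a i ≺ lookup a j

  -- Back-and-forth relations ∼^γ, for γ an element of a well-order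
  -- (O, <ᵒ) (every ordinal is the order type of such an element).
  -- γ = 0 means γ is the least element (no predecessor).
  module BF {O : Set} (_<ᵒ_ : Rel O 0ℓ) where

    IsZero : O → Set
    IsZero γ = ∀ (β : O) → ¬ (β <ᵒ γ)

    Sim′ : (γ : O) → Acc _<ᵒ_ γ → {n : ℕ} → Vec LG n → Vec LG n → Set
    Sim′ γ (acc rs) {n} a b =
        (IsZero γ → SameAtomic a b)
      × (∀ {β : O} (β<γ : β <ᵒ γ) (m : ℕ) →
           (∀ (c : Vec LG m) → ∃[ d ] Sim′ β (rs β<γ) (a ++ c) (b ++ d))
         × (∀ (d : Vec LG m) → ∃[ c ] Sim′ β (rs β<γ) (a ++ c) (b ++ d)))

    Sim : WellFounded _<ᵒ_ → (γ : O) → {n : ℕ} → Vec LG n → Vec LG n → Set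
    Sim wf γ = Sim′ γ (wf γ)

-- An element of L(G) begins with a rational, its lead, and L(G) is ordered by
-- leads first.  Two tuples whose leads lie in the same dense sets A_n and in the
-- same relative order, and which agree after their leads, are ∼^γ for every γ:
-- an extension of one is answered in the other by moving leads inside the dense
-- sets A_n.  An element of length 2 is a rational of A₁ followed by 0, and no
-- other element has the same lead; so the hypotheses cut both concatenations into
-- two blocks at the lead of one element.  For tuples cut in this way the theorem
-- follows by induction on γ: a new tuple is split at the cut, each half is
-- answered on its own side, the answers are moved back to their side of the cut
-- without changing their ∼^β-type, and the halves are glued by the induction
-- hypothesis.

module Submission where

open import Defs
open import Level using (0ℓ)
open import Data.Bool using (Bool; true; false; if_then_else_)
open import Data.Nat as ℕ using (ℕ; zero; suc; z≤n; s≤s)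
import Data.Nat.Properties as ℕₚ
open import Data.Rational as ℚ using (ℚ; 0ℚ; 1ℚ; _<_; _≤_; _<?_; _≤?_; _≟_; _⊔_; _⊓_)
open import Data.Rational.Properties as ℚₚ
  using (<-irrefl; <-asym; <-trans; <-cmp; <⇒≤; ≤-refl; ≤-trans; ≤-<-trans; <-≤-trans; ≰⇒>)
open import Data.Fin using (Fin; zero; suc; _↑ˡ_; _↑ʳ_; splitAt; inject₁; fromℕ)
open import Data.Fin.Properties using (any?)
open import Data.Vec using (Vec; []; _∷_; lookup; _++_; tabulate; head; tail; last)
open import Data.Vec.Properties using (lookup-++ˡ; lookup-++ʳ; lookup-splitAt; lookup∘tabulate)
open import Data.List as List using (List)
open import Data.List.Properties using (∷-injective)
open import Data.List.Relation.Binary.Lex.Core using (this; next)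
open import Data.List.Relation.Binary.Lex.Strict using (Lex-<; <-irreflexive)
import Data.List.Relation.Binary.Pointwise as Pointwise
open import Data.Product using (∃-syntax; _×_; _,_; proj₁; proj₂; map₂)
open import Data.Sum using (_⊎_; inj₁; inj₂; [_,_]′)
open import Data.Empty using (⊥; ⊥-elim)
open import Data.Unit using (⊤; tt)
open import Function using (_∘_; const; id; _⇔_; mk⇔; Equivalence)
open import Function.Properties.Equivalence using () renaming (sym to ⇔-sym; trans to ⇔-trans)
open import Relation.Nullary using (¬_; Dec; yes; no; does)
open import Relation.Nullary.Decidable using (decidable-stable)
open import Relation.Binary using (Rel; IsStrictTotalOrder; tri<; tri≈; tri>)
open import Relation.Binary.PropositionalEquality
  using (_≡_; _≢_; refl; sym; trans; cong; cong₂; subst; subst₂; _≗_)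
open import Induction.WellFounded using (Acc; acc; WellFounded)

open Equivalence using (to; from)

liftIndex : ∀ {k n} m → (Fin k → Fin n) → Fin (k ℕ.+ m) → Fin (n ℕ.+ m)
liftIndex {k} {n} m σ = [ (λ i → σ i ↑ˡ m) , n ↑ʳ_ ]′ ∘ splitAt k

-- Where the entries of (a₁ ++ a₂) ++ e sit in (a₁ ++ u) ++ (a₂ ++ v) when the
-- k-th entry of e is placed in u if b k holds and in v otherwise.
interleave : ∀ n₁ n₂ {m} → (Fin m → Bool) → Fin ((n₁ ℕ.+ n₂) ℕ.+ m) → Fin ((n₁ ℕ.+ m) ℕ.+ (n₂ ℕ.+ m))
interleave n₁ n₂ {m} b =
  [ [ (λ i → (i ↑ˡ m) ↑ˡ (n₂ ℕ.+ m)) , (λ i → (n₁ ℕ.+ m) ↑ʳ (i ↑ˡ m)) ]′ ∘ splitAt n₁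
  , (λ k → if b k then (n₁ ↑ʳ k) ↑ˡ (n₂ ℕ.+ m) else (n₁ ℕ.+ m) ↑ʳ (n₂ ↑ʳ k)) ]′
  ∘ splitAt (n₁ ℕ.+ n₂)

module _ {A : Set} where

  lookup-++-pointwise : ∀ {B : Set} {R : A → B → Set} {n m} (a : Vec A n) (c : Vec B n)
                        {b : Vec A m} {d : Vec B m} →
                        (∀ i → R (lookup a i) (lookup c i)) → (∀ k → R (lookup b k) (lookup d k)) →
                        ∀ i → R (lookup (a ++ b) i) (lookup (c ++ d) i)
  lookup-++-pointwise []      []      _  on-b i       = on-b i
  lookup-++-pointwise (_ ∷ _) (_ ∷ _) on-a _    zero    = on-a zero
  lookup-++-pointwise {R = R} (_ ∷ a) (_ ∷ c) on-a on-b (suc i) =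
    lookup-++-pointwise {R = R} a c (on-a ∘ suc) on-b i

  lookup-++-all : ∀ {P : A → Set} {n m} (a : Vec A n) {b : Vec A m} →
                  (∀ i → P (lookup a i)) → (∀ k → P (lookup b k)) → ∀ i → P (lookup (a ++ b) i)
  lookup-++-all {P} a {b} on-a on-b = lookup-++-pointwise {R = λ u _ → P u} a a {b} {b} on-a on-b

  lookup-++-reindex : ∀ {k₁ k₂ n} (a₁ : Vec A k₁) {a₂ : Vec A k₂} (a : Vec A n)
                      {σ₁ : Fin k₁ → Fin n} {σ₂ : Fin k₂ → Fin n} →
                      lookup a₁ ≗ lookup a ∘ σ₁ → lookup a₂ ≗ lookup a ∘ σ₂ →
                      lookup (a₁ ++ a₂) ≗ lookup a ∘ [ σ₁ , σ₂ ]′ ∘ splitAt k₁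
  lookup-++-reindex {k₁} a₁ {a₂} a {σ₁} {σ₂} on-a₁ on-a₂ i =
    trans (lookup-splitAt k₁ a₁ a₂ i) (by-side (splitAt k₁ i))
    where
    by-side : ∀ s → [ lookup a₁ , lookup a₂ ]′ s ≡ lookup a ([ σ₁ , σ₂ ]′ s)
    by-side (inj₁ j) = on-a₁ j
    by-side (inj₂ j) = on-a₂ j

  lookup-++-swap : ∀ {n m} (a : Vec A n) (c : Vec A m) →
                   lookup (a ++ c) ≗ lookup (c ++ a) ∘ [ m ↑ʳ_ , _↑ˡ n ]′ ∘ splitAt n
  lookup-++-swap a c = lookup-++-reindex a (c ++ a) (sym ∘ lookup-++ʳ c a) (sym ∘ lookup-++ˡ c a)

  lookup-++-liftIndex : ∀ {k n m} (a : Vec A n) (a' : Vec A k) (σ : Fin k → Fin n) →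
                        lookup a' ≗ lookup a ∘ σ → (c : Vec A m) →
                        lookup (a' ++ c) ≗ lookup (a ++ c) ∘ liftIndex m σ
  lookup-++-liftIndex a a' σ on-a' c =
    lookup-++-reindex a' (a ++ c) (λ i → trans (on-a' i) (sym (lookup-++ˡ a c (σ i)))) (sym ∘ lookup-++ʳ a c)

  select : ∀ {m} → (Fin m → Bool) → (Fin m → A) → (Fin m → A) → Vec A m
  select b f g = tabulate λ k → if b k then f k else g k

  lookup-select : ∀ {m} (b : Fin m → Bool) (f g : Fin m → A) k →
                  lookup (select b f g) k ≡ (if b k then f k else g k)
  lookup-select b f g = lookup∘tabulate _

  lookup-select-split : ∀ {m} (b : Fin m → Bool) (e : Vec A m) (f g : Fin m → A) k →
                        lookup e k ≡ (if b k then lookup (select b (lookup e) f) k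
                                               else lookup (select b g (lookup e)) k)
  lookup-select-split b e f g k
    rewrite lookup-select b (lookup e) f k | lookup-select b g (lookup e) k with b k
  ... | true  = refl
  ... | false = refl

  lookup-interleave : ∀ {n₁ n₂ m} (a₁ : Vec A n₁) (a₂ : Vec A n₂) (u v e : Vec A m) (b : Fin m → Bool) →
                      (∀ k → lookup e k ≡ (if b k then lookup u k else lookup v k)) →
                      lookup ((a₁ ++ a₂) ++ e) ≗ lookup ((a₁ ++ u) ++ (a₂ ++ v)) ∘ interleave n₁ n₂ b
  lookup-interleave {n₁} {n₂} {m} a₁ a₂ u v e b e-split =
    lookup-++-reindex (a₁ ++ a₂) merged (lookup-++-reindex a₁ merged in-a₁ in-a₂) in-e
    where
    merged : Vec A ((n₁ ℕ.+ m) ℕ.+ (n₂ ℕ.+ m))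
    merged = (a₁ ++ u) ++ (a₂ ++ v)
    in-a₁ : ∀ i → lookup a₁ i ≡ lookup merged ((i ↑ˡ m) ↑ˡ (n₂ ℕ.+ m))
    in-a₁ i = sym (trans (lookup-++ˡ (a₁ ++ u) (a₂ ++ v) (i ↑ˡ m)) (lookup-++ˡ a₁ u i))
    in-a₂ : ∀ i → lookup a₂ i ≡ lookup merged ((n₁ ℕ.+ m) ↑ʳ (i ↑ˡ m))
    in-a₂ i = sym (trans (lookup-++ʳ (a₁ ++ u) (a₂ ++ v) (i ↑ˡ m)) (lookup-++ˡ a₂ v i))
    in-e : ∀ k → lookup e k ≡ lookup merged
                               (if b k then (n₁ ↑ʳ k) ↑ˡ (n₂ ℕ.+ m) else (n₁ ℕ.+ m) ↑ʳ (n₂ ↑ʳ k))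
    in-e k rewrite e-split k with b k
    ... | true  = sym (trans (lookup-++ˡ (a₁ ++ u) (a₂ ++ v) (n₁ ↑ʳ k)) (lookup-++ʳ a₁ u k))
    ... | false = sym (trans (lookup-++ʳ (a₁ ++ u) (a₂ ++ v) (n₂ ↑ʳ k)) (lookup-++ʳ a₂ v k))

p<p+1 : ∀ p → p < p ℚ.+ 1ℚ
p<p+1 p = subst (_< p ℚ.+ 1ℚ) (ℚₚ.+-identityʳ p) (ℚₚ.+-monoʳ-< p (ℚₚ.positive⁻¹ 1ℚ))

p-1<p : ∀ p → p ℚ.- 1ℚ < p
p-1<p p = subst (p ℚ.- 1ℚ <_) (ℚₚ.+-identityʳ p) (ℚₚ.+-monoʳ-< p (ℚₚ.negative⁻¹ (ℚ.- 1ℚ)))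

⊔-< : ∀ {p q r} → p < r → q < r → p ⊔ q < r
⊔-< {p} {q} p<r q<r with ℚₚ.⊔-sel p q
... | inj₁ p⊔q≡p = subst (_< _) (sym p⊔q≡p) p<r
... | inj₂ p⊔q≡q = subst (_< _) (sym p⊔q≡q) q<r

<-⊓ : ∀ {p q r} → r < p → r < q → r < p ⊓ q
<-⊓ {p} {q} r<p r<q with ℚₚ.⊓-sel p q
... | inj₁ p⊓q≡p = subst (_ <_) (sym p⊓q≡p) r<p
... | inj₂ p⊓q≡q = subst (_ <_) (sym p⊓q≡q) r<q

≮∧≢⇒> : ∀ {p q} → ¬ p < q → p ≢ q → q < p
≮∧≢⇒> {p} {q} p≮q p≢q with <-cmp p q
... | tri< p<q _ _ = ⊥-elim (p≮q p<q)
... | tri≈ _ p≡q _ = ⊥-elim (p≢q p≡q)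
... | tri> _ _ q<p = q<p

≡-of-<-iffs : ∀ {p p' q q'} → (p < p' ⇔ q < q') → (p' < p ⇔ q' < q) → p ≡ p' → q ≡ q'
≡-of-<-iffs {q = q} {q'} forwards backwards refl with <-cmp q q'
... | tri< q<q' _ _ = ⊥-elim (<-irrefl refl (from forwards q<q'))
... | tri≈ _ q≡q' _ = q≡q'
... | tri> _ _ q'<q = ⊥-elim (<-irrefl refl (from backwards q'<q))

∃-upper-bound : ∀ (p : ℚ) {n} (h : Fin n → ℚ) → ∃[ B ] (p < B × ∀ i → h i < B)
∃-upper-bound p {zero}  h = p ℚ.+ 1ℚ , p<p+1 p , λ ()
∃-upper-bound p {suc n} h =
  let B , p⊔h₀<B , h<B = ∃-upper-bound (p ⊔ h zero) (h ∘ suc)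
  in B , ≤-<-trans (ℚₚ.p≤p⊔q p (h zero)) p⊔h₀<B ,
     λ { zero → ≤-<-trans (ℚₚ.p≤q⊔p p (h zero)) p⊔h₀<B ; (suc i) → h<B i }

∃-lower-bound : ∀ (p : ℚ) {n} (h : Fin n → ℚ) → ∃[ B ] (B < p × ∀ i → B < h i)
∃-lower-bound p {zero}  h = p ℚ.- 1ℚ , p-1<p p , λ ()
∃-lower-bound p {suc n} h =
  let B , B<p⊓h₀ , B<h = ∃-lower-bound (p ⊓ h zero) (h ∘ suc)
  in B , <-≤-trans B<p⊓h₀ (ℚₚ.p⊓q≤p p (h zero)) ,
     λ { zero → <-≤-trans B<p⊓h₀ (ℚₚ.p⊓q≤q p (h zero)) ; (suc i) → B<h i }

module DensePartition
  (part : ℚ → ℕ)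
  (part-dense : ∀ (n : ℕ) (p q : ℚ) → p < q → ∃[ r ] (p < r × r < q × part r ≡ n))
  where

  part-dense-cut : ∀ c {n} (h : Fin n → ℚ) (P : Fin n → Set) → (∀ i → Dec (P i)) →
                   (∀ i j → P i → ¬ P j → h i < h j) →
                   ∀ {lo hi} → lo < hi → (∀ i → P i → h i < hi) → (∀ j → ¬ P j → lo < h j) →
                   ∃[ v ] (part v ≡ c × lo < v × v < hi ×
                           (∀ i → P i → h i < v) × (∀ j → ¬ P j → v < h j))
  part-dense-cut c {zero} h P P? cut lo<hi _ _ =
    let v , lo<v , v<hi , part-v = part-dense c _ _ lo<hi
    in v , part-v , lo<v , v<hi , (λ ()) , (λ ())
  part-dense-cut c {suc n} h P P? cut {lo} {hi} lo<hi P<hi lo<¬P with P? zero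
  ... | yes P₀ =
    let v , part-v , lo⊔h₀<v , v<hi , P<v , v<¬P =
          part-dense-cut c (h ∘ suc) (P ∘ suc) (P? ∘ suc) (λ i j → cut (suc i) (suc j))
            (⊔-< lo<hi (P<hi zero P₀)) (P<hi ∘ suc)
            (λ j ¬Pj → ⊔-< (lo<¬P (suc j) ¬Pj) (cut zero (suc j) P₀ ¬Pj))
    in v , part-v , ≤-<-trans (ℚₚ.p≤p⊔q lo (h zero)) lo⊔h₀<v , v<hi ,
       (λ { zero _ → ≤-<-trans (ℚₚ.p≤q⊔p lo (h zero)) lo⊔h₀<v ; (suc i) → P<v i }) ,
       (λ { zero ¬P₀ → ⊥-elim (¬P₀ P₀) ; (suc j) → v<¬P j })
  ... | no ¬P₀ =
    let v , part-v , lo<v , v<hi⊓h₀ , P<v , v<¬P =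
          part-dense-cut c (h ∘ suc) (P ∘ suc) (P? ∘ suc) (λ i j → cut (suc i) (suc j))
            (<-⊓ lo<hi (lo<¬P zero ¬P₀))
            (λ i Pi → <-⊓ (P<hi (suc i) Pi) (cut (suc i) zero Pi ¬P₀)) (lo<¬P ∘ suc)
    in v , part-v , lo<v , <-≤-trans v<hi⊓h₀ (ℚₚ.p⊓q≤p hi (h zero)) ,
       (λ { zero P₀ → ⊥-elim (¬P₀ P₀) ; (suc i) → P<v i }) ,
       (λ { zero _ → <-≤-trans v<hi⊓h₀ (ℚₚ.p⊓q≤q hi (h zero)) ; (suc j) → v<¬P j })

  ∃-part-cut : ∀ c {n} (h : Fin n → ℚ) (P : Fin n → Set) → (∀ i → Dec (P i)) →
               (∀ i j → P i → ¬ P j → h i < h j) →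
               ∃[ v ] (part v ≡ c × (∀ i → P i → h i < v) × (∀ j → ¬ P j → v < h j))
  ∃-part-cut c h P P? cut =
    let hi , _ , h<hi = ∃-upper-bound 0ℚ h
        lo , lo<hi , lo<h = ∃-lower-bound hi h
        v , part-v , _ , _ , P<v , v<¬P =
          part-dense-cut c h P P? cut lo<hi (λ i _ → h<hi i) (λ j _ → lo<h j)
    in v , part-v , P<v , v<¬P

  ∃-part-above : ∀ c {n} (h : Fin n → ℚ) → ∃[ v ] (part v ≡ c × ∀ i → h i < v)
  ∃-part-above c h =
    let v , part-v , h<v , _ = ∃-part-cut c h (λ _ → ⊤) (λ _ → yes tt) (λ _ _ _ ¬⊤ → ⊥-elim (¬⊤ tt))
    in v , part-v , λ i → h<v i tt

  ∃-part-below : ∀ c {n} (h : Fin n → ℚ) → ∃[ v ] (part v ≡ c × ∀ i → v < h i)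
  ∃-part-below c h =
    let v , part-v , _ , v<h = ∃-part-cut c h (λ _ → ⊥) (λ _ → no id) (λ _ _ ())
    in v , part-v , λ i → v<h i id

  ∃-part-gap : ∀ c (r : ℚ) {n} (h : Fin n → ℚ) → (∀ i → r < h i) →
               ∃[ v ] (part v ≡ c × r < v × ∀ i → v < h i)
  ∃-part-gap c r h r<h =
    let hi , r<hi , _ = ∃-upper-bound r h
        v , part-v , r<v , _ , _ , v<h =
          part-dense-cut c h (λ _ → ⊥) (λ _ → no id) (λ _ _ ()) r<hi (λ _ ()) (λ j _ → r<h j)
    in v , part-v , r<v , λ i → v<h i id

  extend-order : ∀ {n} (p q : Fin n → ℚ) → (∀ i → part (p i) ≡ part (q i)) →
                 (∀ i j → p i < p j ⇔ q i < q j) → ∀ u →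
                 ∃[ v ] (part v ≡ part u × (∀ i → p i < u ⇔ q i < v) × (∀ i → u < p i ⇔ v < q i))
  extend-order p q same-part same-order u with any? (λ i → p i ≟ u)
  ... | yes (i₀ , refl) = q i₀ , sym (same-part i₀) , (λ i → same-order i i₀) , (λ i → same-order i₀ i)
  ... | no u∉p =
    let v , part-v , below , above =
          ∃-part-cut (part u) q (λ i → p i < u) (λ i → p i <? u)
            (λ i j pi<u pj≮u → to (same-order i j) (<-trans pi<u (u<p j pj≮u)))
    in v , part-v ,
       (λ i → mk⇔ (below i) (λ qi<v → decidable-stable (p i <? u) (<-asym qi<v ∘ above i))) ,
       (λ i → mk⇔ (λ u<pi → above i (<-asym u<pi))
                  (λ v<qi → u<p i (λ pi<u → <-asym v<qi (below i pi<u))))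
    where
    u<p : ∀ j → ¬ p j < u → u < p j
    u<p j pj≮u = ≮∧≢⇒> pj≮u (λ pj≡u → u∉p (j , pj≡u))

weaveTail : ∀ {n} → Vec ℚ n → Vec ℚ n → List ℚ
weaveTail _  []       = List.[]
weaveTail rs (q ∷ qs) = q List.∷ weave rs qs

weave-head : ∀ {n} (r : Vec ℚ (suc n)) (q : Vec ℚ n) → weave r q ≡ head r List.∷ weaveTail (tail r) q
weave-head (_ ∷ []) []      = refl
weave-head (_ ∷ _)  (_ ∷ _) = refl

module _ (S : Setting) (G : DiGraph) where
  open Setting S
  open DensePartition part part-dense

  private
    L : Set
    L = LG S G

    _≺ᴸ_ _≈ᴸ_ : L → L → Set
    _≺ᴸ_ = _≺_ S G
    _≈ᴸ_ = _≈_ S G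

    _<lex_ : List ℚ → List ℚ → Set
    _<lex_ = Lex-< _≡_ _<_

  lead : L → ℚ
  lead (_ , _ , r , _) = head r

  rest : L → List ℚ
  rest (_ , _ , r , q , _ , k , _) = weaveTail (tail r) q List.++ ℕ→ℚ k List.∷ List.[]

  seq≡lead∷rest : ∀ x → seq S G x ≡ lead x List.∷ rest x
  seq≡lead∷rest (_ , _ , r , q , _ , _ , _ , seq≡ , _) = trans seq≡ (cong (List._++ _) (weave-head r q))

  part-lookup-replace-head : ∀ {n u} (r : Vec ℚ (suc n)) → part u ≡ part (head r) →
                             ∀ i → part (lookup (u ∷ tail r) i) ≡ part (lookup r i)
  part-lookup-replace-head (_ ∷ _) part-u zero    = part-u
  part-lookup-replace-head (_ ∷ _) part-u (suc i) = refl

  relocate : (x : L) (u : ℚ) → part u ≡ part (lead x) → L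
  relocate (_ , n , r , q , a , k , j , _ , r-in-A₀ , r-in-A₁ , a-inj , a-in-V , q-in-A , a-type , k<m)
           u part-u =
    weave (u ∷ tail r) q List.++ ℕ→ℚ k List.∷ List.[] , n , u ∷ tail r , q , a , k , j , refl ,
    (λ i → trans (part-lookup-replace-head r part-u (inject₁ i)) (r-in-A₀ i)) ,
    trans (part-lookup-replace-head r part-u (fromℕ n)) r-in-A₁ ,
    a-inj , a-in-V , q-in-A , a-type , k<m

  ≺-lead : ∀ {x y} → x ≺ᴸ y → lead x < lead y ⊎ (lead x ≡ lead y × rest x <lex rest y)
  ≺-lead {x} {y} x≺y with subst₂ _<lex_ (seq≡lead∷rest x) (seq≡lead∷rest y) x≺y
  ... | this lt      = inj₁ lt
  ... | next eq rest< = inj₂ (eq , rest<)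

  lead-<⇒≺ : ∀ {x y} → lead x < lead y → x ≺ᴸ y
  lead-<⇒≺ {x} {y} lt = subst₂ _<lex_ (sym (seq≡lead∷rest x)) (sym (seq≡lead∷rest y)) (this lt)

  lead-≡⇒≺ : ∀ {x y} → lead x ≡ lead y → rest x <lex rest y → x ≺ᴸ y
  lead-≡⇒≺ {x} {y} eq rest< = subst₂ _<lex_ (sym (seq≡lead∷rest x)) (sym (seq≡lead∷rest y)) (next eq rest<)

  ≈⇒lead-rest : ∀ {x y} → x ≈ᴸ y → lead x ≡ lead y × rest x ≡ rest y
  ≈⇒lead-rest {x} {y} x≈y = ∷-injective (trans (sym (seq≡lead∷rest x)) (trans x≈y (seq≡lead∷rest y)))

  lead-rest⇒≈ : ∀ {x y} → lead x ≡ lead y → rest x ≡ rest y → x ≈ᴸ y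
  lead-rest⇒≈ {x} {y} lead≡ rest≡ =
    trans (seq≡lead∷rest x) (trans (cong₂ List._∷_ lead≡ rest≡) (sym (seq≡lead∷rest y)))

  ≺⇒lead-≤ : ∀ {x y} → x ≺ᴸ y → lead x ≤ lead y
  ≺⇒lead-≤ {x} {y} x≺y with ≺-lead {x} {y} x≺y
  ... | inj₁ lt       = <⇒≤ lt
  ... | inj₂ (eq , _) = ℚₚ.≤-reflexive eq

  lead-<⇒⊁ : ∀ {x y} → lead x < lead y → ¬ y ≺ᴸ x
  lead-<⇒⊁ {x} {y} lt y≺x with ≺-lead {y} {x} y≺x
  ... | inj₁ gt       = <-asym lt gt
  ... | inj₂ (eq , _) = <-irrefl (sym eq) lt

  lead-<⇒≉ : ∀ {x y} → lead x < lead y → ¬ x ≈ᴸ y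
  lead-<⇒≉ {x} {y} lt x≈y = <-irrefl (proj₁ (≈⇒lead-rest {x} {y} x≈y)) lt

  AtomicPair : L → L → L → L → Set
  AtomicPair u v u' v' = (u ≺ᴸ v ⇔ u' ≺ᴸ v') × (u ≈ᴸ v ⇔ u' ≈ᴸ v')

  AtomicPair-lead-< : ∀ {u v u' v'} → lead u < lead v → lead u' < lead v' → AtomicPair u v u' v'
  AtomicPair-lead-< {u} {v} {u'} {v'} lt lt' =
    mk⇔ (const (lead-<⇒≺ {u'} {v'} lt')) (const (lead-<⇒≺ {u} {v} lt)) ,
    mk⇔ (⊥-elim ∘ lead-<⇒≉ {u} {v} lt) (⊥-elim ∘ lead-<⇒≉ {u'} {v'} lt')

  AtomicPair-lead-> : ∀ {u v u' v'} → lead v < lead u → lead v' < lead u' → AtomicPair u v u' v'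
  AtomicPair-lead-> {u} {v} {u'} {v'} gt gt' =
    mk⇔ (⊥-elim ∘ lead-<⇒⊁ {v} {u} gt) (⊥-elim ∘ lead-<⇒⊁ {v'} {u'} gt') ,
    mk⇔ (⊥-elim ∘ lead-<⇒≉ {v} {u} gt ∘ sym) (⊥-elim ∘ lead-<⇒≉ {v'} {u'} gt' ∘ sym)

  arity-0 : (τ : AtType) → arity τ ≡ 0 → τ ≡ atType G []
  arity-0 (zero , []) _ = refl

  empty-type-index : ∀ {j} → enum j ≡ atType G [] → j ≡ 0
  empty-type-index {j} enum-j = sym (enum-inj (trans (arity-0 (enum 0) arity-enum-0) (sym enum-j)))
    where
    arity-enum-0 : arity (enum 0) ≡ 0
    arity-enum-0 = ℕₚ.n≤0⇒n≡0 (subst (arity (enum 0) ℕ.≤_) (cong arity enum-j) (enum-mono z≤n))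

  -- A lead in A₁ forces n = 0, so the realised type is t₁ and k < 1.
  rest-of-A₁ : ∀ x → part (lead x) ≡ 1 → rest x ≡ ℕ→ℚ 0 List.∷ List.[]
  rest-of-A₁ (_ , zero , _ ∷ [] , [] , [] , _ , _ , _ , _ , _ , _ , _ , _ , a-type , k<m) _
    with empty-type-index a-type
  ... | refl with k<m
  ...   | s≤s z≤n = refl
  rest-of-A₁ (_ , suc _ , _ ∷ _ , _ , _ , _ , _ , _ , r-in-A₀ , _) lead-in-A₁
    with trans (sym (r-in-A₀ zero)) lead-in-A₁
  ... | ()

  length-2⇒A₁ : ∀ x → len S G x ≡ 2 → part (lead x) ≡ 1
  length-2⇒A₁ (_ , zero , _ ∷ [] , _ , _ , _ , _ , _ , _ , r-in-A₁ , _) _ = r-in-A₁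
  length-2⇒A₁ (_ , suc zero , _ ∷ _ ∷ [] , _ ∷ [] , _ , _ , _ , refl , _) ()
  length-2⇒A₁ (_ , suc (suc _) , _ ∷ _ ∷ _ , _ ∷ _ ∷ _ , _ , _ , _ , refl , _) ()

  <lex-irrefl : ∀ {xs} → ¬ xs <lex xs
  <lex-irrefl = <-irreflexive <-irrefl (Pointwise.refl refl)

  ≺A₁⇒lead< : ∀ {a x} → part (lead x) ≡ 1 → a ≺ᴸ x → lead a < lead x
  ≺A₁⇒lead< {a} {x} x-in-A₁ a≺x with ≺-lead {a} {x} a≺x
  ... | inj₁ lt = lt
  ... | inj₂ (eq , rest<) =
    ⊥-elim (<lex-irrefl (subst₂ _<lex_ (rest-of-A₁ a (trans (cong part eq) x-in-A₁)) (rest-of-A₁ x x-in-A₁)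
                                       rest<))

  A₁≺⇒lead< : ∀ {a x} → part (lead x) ≡ 1 → x ≺ᴸ a → lead x < lead a
  A₁≺⇒lead< {a} {x} x-in-A₁ x≺a with ≺-lead {x} {a} x≺a
  ... | inj₁ lt = lt
  ... | inj₂ (eq , rest<) =
    ⊥-elim (<lex-irrefl (subst₂ _<lex_ (rest-of-A₁ x x-in-A₁) (rest-of-A₁ a (trans (cong part (sym eq)) x-in-A₁))
                                       rest<))

  record Alike {I : Set} (f g : I → L) : Set where
    field
      same-rest  : ∀ i → rest (f i) ≡ rest (g i)
      same-part  : ∀ i → part (lead (f i)) ≡ part (lead (g i))
      same-order : ∀ i j → lead (f i) < lead (f j) ⇔ lead (g i) < lead (g j)

  open Alike

  Alike-refl : ∀ {I} (f : I → L) → Alike f f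
  Alike-refl f = record { same-rest = λ _ → refl ; same-part = λ _ → refl ; same-order = λ _ _ → mk⇔ id id }

  Alike-sym : ∀ {I} {f g : I → L} → Alike f g → Alike g f
  Alike-sym al = record
    { same-rest  = sym ∘ same-rest al
    ; same-part  = sym ∘ same-part al
    ; same-order = λ i j → ⇔-sym (same-order al i j)
    }

  Alike-reindex : ∀ {I J} {f g : I → L} {f' g' : J → L} (σ : J → I) →
                  f' ≗ f ∘ σ → g' ≗ g ∘ σ → Alike f g → Alike f' g'
  Alike-reindex {f' = f'} {g'} σ on-f' on-g' al = record
    { same-rest = rest≡ ; same-part = part≡ ; same-order = order⇔ }
    where
    rest≡ : ∀ i → rest (f' i) ≡ rest (g' i)
    rest≡ i rewrite on-f' i | on-g' i = same-rest al (σ i)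
    part≡ : ∀ i → part (lead (f' i)) ≡ part (lead (g' i))
    part≡ i rewrite on-f' i | on-g' i = same-part al (σ i)
    order⇔ : ∀ i j → lead (f' i) < lead (f' j) ⇔ lead (g' i) < lead (g' j)
    order⇔ i j rewrite on-f' i | on-f' j | on-g' i | on-g' j = same-order al (σ i) (σ j)

  Alike-∷ : ∀ {n} {a b : Vec L n} {e d : L} → Alike (lookup a) (lookup b) →
            rest e ≡ rest d → part (lead e) ≡ part (lead d) →
            (∀ i → lead (lookup a i) < lead e ⇔ lead (lookup b i) < lead d) →
            (∀ i → lead e < lead (lookup a i) ⇔ lead d < lead (lookup b i)) →
            Alike (lookup (e ∷ a)) (lookup (d ∷ b))
  Alike-∷ {a = a} {b} {e} {d} al rest≡ part≡ below above = record
    { same-rest  = λ { zero → rest≡ ; (suc i) → same-rest al i }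
    ; same-part  = λ { zero → part≡ ; (suc i) → same-part al i }
    ; same-order = order⇔
    }
    where
    order⇔ : ∀ i j → lead (lookup (e ∷ a) i) < lead (lookup (e ∷ a) j)
                   ⇔ lead (lookup (d ∷ b) i) < lead (lookup (d ∷ b) j)
    order⇔ zero    zero    = mk⇔ (⊥-elim ∘ <-irrefl refl) (⊥-elim ∘ <-irrefl refl)
    order⇔ zero    (suc j) = above j
    order⇔ (suc i) zero    = below i
    order⇔ (suc i) (suc j) = same-order al i j

  Alike-≺ : ∀ {I} {f g : I → L} → Alike f g → ∀ i j → f i ≺ᴸ f j → g i ≺ᴸ g j
  Alike-≺ {f = f} {g} al i j fi≺fj with ≺-lead {f i} {f j} fi≺fj
  ... | inj₁ lt = lead-<⇒≺ {g i} {g j} (to (same-order al i j) lt)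
  ... | inj₂ (eq , rest<) =
    lead-≡⇒≺ {g i} {g j} (≡-of-<-iffs (same-order al i j) (same-order al j i) eq)
                          (subst₂ _<lex_ (same-rest al i) (same-rest al j) rest<)

  Alike-≈ : ∀ {I} {f g : I → L} → Alike f g → ∀ i j → f i ≈ᴸ f j → g i ≈ᴸ g j
  Alike-≈ {f = f} {g} al i j fi≈fj =
    let lead≡ , rest≡ = ≈⇒lead-rest {f i} {f j} fi≈fj
    in lead-rest⇒≈ {g i} {g j} (≡-of-<-iffs (same-order al i j) (same-order al j i) lead≡)
                               (trans (sym (same-rest al i)) (trans rest≡ (same-rest al j)))

  Alike⇒SameAtomic : ∀ {n} {a b : Vec L n} → Alike (lookup a) (lookup b) → SameAtomic S G a b
  Alike⇒SameAtomic al i j =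
    mk⇔ (Alike-≺ al i j) (Alike-≺ (Alike-sym al) i j) , mk⇔ (Alike-≈ al i j) (Alike-≈ (Alike-sym al) i j)

  Alike-extend : ∀ {n} {a b : Vec L n} → Alike (lookup a) (lookup b) →
                 ∀ e → ∃[ d ] Alike (lookup (e ∷ a)) (lookup (d ∷ b))
  Alike-extend {a = a} {b} al e =
    let v , part-v , below , above =
          extend-order (lead ∘ lookup a) (lead ∘ lookup b) (same-part al) (same-order al) (lead e)
    in relocate e v part-v , Alike-∷ al refl (sym part-v) below above

  Alike-prepend : ∀ {n m} {a b : Vec L n} → Alike (lookup a) (lookup b) →
                  (c : Vec L m) → ∃[ d ] Alike (lookup (c ++ a)) (lookup (d ++ b))
  Alike-prepend al []      = [] , al
  Alike-prepend al (e ∷ c) =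
    let d , al′ = Alike-prepend al c
        d₀ , al″ = Alike-extend al′ e
    in d₀ ∷ d , al″

  Alike-append : ∀ {n m} {a b : Vec L n} → Alike (lookup a) (lookup b) →
                 (c : Vec L m) → ∃[ d ] Alike (lookup (a ++ c)) (lookup (b ++ d))
  Alike-append {a = a} {b} al c =
    let d , al′ = Alike-prepend al c
    in d , Alike-reindex _ (lookup-++-swap a c) (lookup-++-swap b d) al′

  LeadsBelow : ℚ → ∀ {n} → Vec L n → Set
  LeadsBelow r a = ∀ i → lead (lookup a i) < r

  LeadsAbove : ℚ → ∀ {n} → Vec L n → Set
  LeadsAbove r a = ∀ i → r < lead (lookup a i)

  record Separates (x : L) {n₁ n₂} (a₁ : Vec L n₁) (a₂ : Vec L n₂) : Set where
    constructor separates
    field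
      left-below  : LeadsBelow (lead x) a₁
      right-above : LeadsAbove (lead x) a₂

  -- A copy z of y with its lead above c ++ d is alike to y over c; extending
  -- z ∷ c ↦ y ∷ c by d moves d below y.
  squeeze-below : ∀ {n m} (y : L) (c : Vec L n) → LeadsBelow (lead y) c → (d : Vec L m) →
                  ∃[ d' ] (Alike (lookup (c ++ d)) (lookup (c ++ d')) × LeadsBelow (lead y) (c ++ d'))
  squeeze-below {m = m} y c c<y d =
    let B , part-B , c++d<B = ∃-part-above (part (lead y)) (lead ∘ lookup (c ++ d))
        c<B = λ i → subst (λ w → lead w < B) (lookup-++ˡ c d i) (c++d<B (i ↑ˡ m))
        z = relocate y B part-B
        anchor = Alike-∷ {e = z} {d = y} (Alike-refl (lookup c)) refl part-B
                   (λ i → mk⇔ (const (c<y i)) (const (c<B i)))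
                   (λ i → mk⇔ (λ B<c → ⊥-elim (<-asym B<c (c<B i))) (λ y<c → ⊥-elim (<-asym y<c (c<y i))))
        d' , al = Alike-append {a = z ∷ c} {b = y ∷ c} anchor d
    in d' , Alike-reindex suc (λ _ → refl) (λ _ → refl) al , λ i → to (same-order al (suc i) zero) (c++d<B i)

  squeeze-above : ∀ {n m} (y : L) (c : Vec L n) → LeadsAbove (lead y) c → (d : Vec L m) →
                  ∃[ d' ] (Alike (lookup (c ++ d)) (lookup (c ++ d')) × LeadsAbove (lead y) (c ++ d'))
  squeeze-above {m = m} y c y<c d =
    let B , part-B , B<c++d = ∃-part-below (part (lead y)) (lead ∘ lookup (c ++ d))
        B<c = λ i → subst (λ w → B < lead w) (lookup-++ˡ c d i) (B<c++d (i ↑ˡ m))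
        z = relocate y B part-B
        anchor = Alike-∷ {e = z} {d = y} (Alike-refl (lookup c)) refl part-B
                   (λ i → mk⇔ (λ c<B → ⊥-elim (<-asym c<B (B<c i))) (λ c<y → ⊥-elim (<-asym c<y (y<c i))))
                   (λ i → mk⇔ (const (y<c i)) (const (B<c i)))
        d' , al = Alike-append {a = z ∷ c} {b = y ∷ c} anchor d
    in d' , Alike-reindex suc (λ _ → refl) (λ _ → refl) al , λ i → to (same-order al zero (suc i)) (B<c++d i)

  strict-separator : ∀ x {n₁ n₂} (a₁ : Vec L n₁) (a₂ : Vec L n₂) →
                     (∀ i → lead (lookup a₁ i) ≤ lead x) → LeadsAbove (lead x) a₂ → ∃[ x' ] Separates x' a₁ a₂
  strict-separator x a₁ a₂ a₁≤x x<a₂ =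
    let v , part-v , x<v , v<a₂ = ∃-part-gap (part (lead x)) (lead x) (lead ∘ lookup a₂) x<a₂
    in relocate x v part-v , separates (λ i → ≤-<-trans (a₁≤x i) x<v) v<a₂

  shiftUp : L → L
  shiftUp x = relocate x (proj₁ above) (proj₂ (proj₂ (proj₂ above)))
    where
    above = part-dense (part (lead x)) (lead x) (lead x ℚ.+ 1ℚ) (p<p+1 (lead x))

  lead<lead-shiftUp : ∀ x → lead x < lead (shiftUp x)
  lead<lead-shiftUp x = proj₁ (proj₂ (part-dense (part (lead x)) (lead x) (lead x ℚ.+ 1ℚ) (p<p+1 (lead x))))

  leftOf : L → ∀ {m} → Vec L m → Fin m → Bool
  leftOf x e k = does (lead (lookup e k) ≤? lead x)

  leftPart rightPart : L → ∀ {m} → Vec L m → Vec L m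
  leftPart  x e = select (leftOf x e) (lookup e) (const x)
  rightPart x e = select (leftOf x e) (const (shiftUp x)) (lookup e)

  leftPart-≤ : ∀ x {m} (e : Vec L m) k → lead (lookup (leftPart x e) k) ≤ lead x
  leftPart-≤ x e k =
    subst (λ w → lead w ≤ lead x) (sym (lookup-select (leftOf x e) (lookup e) (const x) k))
      (by-side (lead (lookup e k) ≤? lead x))
    where
    by-side : (left? : Dec (lead (lookup e k) ≤ lead x)) →
              lead (if does left? then lookup e k else x) ≤ lead x
    by-side (yes e≤x) = e≤x
    by-side (no  _)   = ≤-refl

  rightPart-> : ∀ x {m} (e : Vec L m) k → lead x < lead (lookup (rightPart x e) k)
  rightPart-> x e k =
    subst (λ w → lead x < lead w) (sym (lookup-select (leftOf x e) (const (shiftUp x)) (lookup e) k))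
      (by-side (lead (lookup e k) ≤? lead x))
    where
    by-side : (left? : Dec (lead (lookup e k) ≤ lead x)) →
              lead x < lead (if does left? then shiftUp x else lookup e k)
    by-side (yes _)   = lead<lead-shiftUp x
    by-side (no  e≰x) = ≰⇒> e≰x

  SameAtomic-sym : ∀ {n} {a b : Vec L n} → SameAtomic S G a b → SameAtomic S G b a
  SameAtomic-sym same i j = ⇔-sym (proj₁ (same i j)) , ⇔-sym (proj₂ (same i j))

  SameAtomic-trans : ∀ {n} {a b c : Vec L n} → SameAtomic S G a b → SameAtomic S G b c → SameAtomic S G a c
  SameAtomic-trans same same′ i j =
    ⇔-trans (proj₁ (same i j)) (proj₁ (same′ i j)) , ⇔-trans (proj₂ (same i j)) (proj₂ (same′ i j))

  SameAtomic-reindex : ∀ {n k} {a b : Vec L n} {a' b' : Vec L k} (σ : Fin k → Fin n) →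
                       lookup a' ≗ lookup a ∘ σ → lookup b' ≗ lookup b ∘ σ →
                       SameAtomic S G a b → SameAtomic S G a' b'
  SameAtomic-reindex σ on-a' on-b' same i j
    rewrite on-a' i | on-a' j | on-b' i | on-b' j = same (σ i) (σ j)

  SameAtomic-++ : ∀ {n₁ n₂} {a₁ c₁ : Vec L n₁} {a₂ c₂ : Vec L n₂} {x y} →
                  Separates x a₁ a₂ → Separates y c₁ c₂ →
                  SameAtomic S G a₁ c₁ → SameAtomic S G a₂ c₂ → SameAtomic S G (a₁ ++ a₂) (c₁ ++ c₂)
  SameAtomic-++ {a₁ = a₁} {c₁} {a₂} {c₂} (separates a₁<x x<a₂) (separates c₁<y y<c₂) same₁ same₂ =
    lookup-++-pointwise {R = λ u u' → ∀ j → AtomicPair u (lookup (a₁ ++ a₂) j) u' (lookup (c₁ ++ c₂) j)}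
      a₁ c₁ {a₂} {c₂} row₁ row₂
    where
    row₁ : ∀ i j → AtomicPair (lookup a₁ i) (lookup (a₁ ++ a₂) j) (lookup c₁ i) (lookup (c₁ ++ c₂) j)
    row₁ i = lookup-++-pointwise {R = λ v v' → AtomicPair (lookup a₁ i) v (lookup c₁ i) v'} a₁ c₁ {a₂} {c₂}
               (same₁ i)
               (λ j → AtomicPair-lead-< {lookup a₁ i} {lookup a₂ j} {lookup c₁ i} {lookup c₂ j}
                        (<-trans (a₁<x i) (x<a₂ j)) (<-trans (c₁<y i) (y<c₂ j)))
    row₂ : ∀ i j → AtomicPair (lookup a₂ i) (lookup (a₁ ++ a₂) j) (lookup c₂ i) (lookup (c₁ ++ c₂) j)
    row₂ i = lookup-++-pointwise {R = λ v v' → AtomicPair (lookup a₂ i) v (lookup c₂ i) v'} a₁ c₁ {a₂} {c₂}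
               (λ j → AtomicPair-lead-> {lookup a₂ i} {lookup a₁ j} {lookup c₂ i} {lookup c₁ j}
                        (<-trans (a₁<x j) (x<a₂ i)) (<-trans (c₁<y j) (y<c₂ i)))
               (same₂ i)

  Increasing-∷⁻ : ∀ {n} {x : L} {a : Vec L n} → Increasing S G (x ∷ a) → Increasing S G a
  Increasing-∷⁻ increasing i j i<j = increasing (suc i) (suc j) (s≤s i<j)

  lead-≤-last : ∀ {n m} (a : Vec L (suc n)) {b : Vec L m} → Increasing S G (a ++ b) →
                ∀ i → lead (lookup a i) ≤ lead (last a)
  lead-≤-last (_ ∷ [])     _          zero    = ≤-refl
  lead-≤-last (x ∷ x′ ∷ a) increasing zero    =
    ≤-trans (≺⇒lead-≤ {x} {x′} (increasing zero (suc zero) (s≤s z≤n)))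
            (lead-≤-last (x′ ∷ a) (Increasing-∷⁻ increasing) zero)
  lead-≤-last (_ ∷ x′ ∷ a) increasing (suc i) = lead-≤-last (x′ ∷ a) (Increasing-∷⁻ increasing) i

  head-≤-lead : ∀ {n m} (a : Vec L n) {b : Vec L (suc m)} → Increasing S G (a ++ b) →
                ∀ j → lead (head b) ≤ lead (lookup b j)
  head-≤-lead [] {_ ∷ _} _          zero    = ≤-refl
  head-≤-lead [] {x ∷ b} increasing (suc j) = ≺⇒lead-≤ {x} {lookup b j} (increasing zero (suc j) (s≤s z≤n))
  head-≤-lead (_ ∷ a)    increasing         = head-≤-lead a (Increasing-∷⁻ increasing)

  length-2-separates : ∀ {n₁ n₂} {x : L} (b₁ : Vec L (suc n₁)) (b₂ : Vec L (suc n₂)) →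
                       Increasing S G (b₁ ++ b₂) → len S G x ≡ 2 → last b₁ ≺ᴸ x → x ≺ᴸ head b₂ →
                       Separates x b₁ b₂
  length-2-separates {x = x} b₁ b₂ increasing len-x b₁≺x x≺b₂ =
    separates
      (λ i → ≤-<-trans (lead-≤-last b₁ increasing i) (≺A₁⇒lead< {last b₁} {x} x-in-A₁ b₁≺x))
      (λ j → <-≤-trans (A₁≺⇒lead< {head b₂} {x} x-in-A₁ x≺b₂) (head-≤-lead b₁ increasing j))
    where
    x-in-A₁ : part (lead x) ≡ 1
    x-in-A₁ = length-2⇒A₁ x len-x

  module _ {O : Set} (_<ᵒ_ : Rel O 0ℓ) where
    open BF S G _<ᵒ_

    Forth : ∀ {γ} → Acc _<ᵒ_ γ → ℕ → ∀ {n} → Vec L n → Vec L n → Set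
    Forth α m a b = ∀ (c : Vec L m) → ∃[ d ] Sim′ _ α (a ++ c) (b ++ d)

    Sim-sym : ∀ {γ} (α : Acc _<ᵒ_ γ) {n} {a b : Vec L n} → Sim′ γ α a b → Sim′ γ α b a
    Sim-sym (acc rs) {a = a} {b} (atomic , extend) =
      SameAtomic-sym {a = a} {b} ∘ atomic ,
      λ β<γ m → let forth , back = extend β<γ m
                in (map₂ (Sim-sym (rs β<γ)) ∘ back) , (map₂ (Sim-sym (rs β<γ)) ∘ forth)

    Sim-trans : ∀ {γ} (α : Acc _<ᵒ_ γ) {n} {a b c : Vec L n} → Sim′ γ α a b → Sim′ γ α b c → Sim′ γ α a c
    Sim-trans (acc rs) {a = a} {b} {c} (atomic , extend) (atomic′ , extend′) =
      (λ γ-zero → SameAtomic-trans {a = a} {b} {c} (atomic γ-zero) (atomic′ γ-zero)) ,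
      λ β<γ m →
        let forth , back = extend β<γ m
            forth′ , back′ = extend′ β<γ m
        in (λ e → let f , sim = forth e ; g , sim′ = forth′ f in g , Sim-trans (rs β<γ) sim sim′) ,
           (λ g → let f , sim′ = back′ g ; e , sim = back f in e , Sim-trans (rs β<γ) sim sim′)

    Sim-reindex : ∀ {γ} (α : Acc _<ᵒ_ γ) {n k} {a b : Vec L n} {a' b' : Vec L k} (σ : Fin k → Fin n) →
                  lookup a' ≗ lookup a ∘ σ → lookup b' ≗ lookup b ∘ σ → Sim′ γ α a b → Sim′ γ α a' b'
    Sim-reindex (acc rs) {a = a} {b} {a'} {b'} σ on-a' on-b' (atomic , extend) =
      SameAtomic-reindex {a = a} {b} {a'} {b'} σ on-a' on-b' ∘ atomic ,
      λ {_} β<γ m →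
        let forth , back = extend β<γ m
            lift : ∀ {c d : Vec L m} → Sim′ _ (rs β<γ) (a ++ c) (b ++ d) → Sim′ _ (rs β<γ) (a' ++ c) (b' ++ d)
            lift {c} {d} = Sim-reindex (rs β<γ) {a = a ++ c} {b ++ d} {a' ++ c} {b' ++ d} (liftIndex m σ)
                             (lookup-++-liftIndex a a' σ on-a' c) (lookup-++-liftIndex b b' σ on-b' d)
        in (map₂ lift ∘ forth) , (map₂ lift ∘ back)

    Alike⇒Sim : ∀ {γ} (α : Acc _<ᵒ_ γ) {n} {a b : Vec L n} → Alike (lookup a) (lookup b) → Sim′ γ α a b
    Alike⇒Sim (acc rs) {a = a} {b} alike =
      const (Alike⇒SameAtomic {a = a} {b} alike) ,
      λ β<γ m → (λ c → map₂ (Alike⇒Sim (rs β<γ)) (Alike-append {a = a} {b} alike c)) ,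
                (λ d → map₂ (Alike⇒Sim (rs β<γ) ∘ Alike-sym) (Alike-append {a = b} {a} (Alike-sym alike) d))

    Glues : ∀ {γ} → Acc _<ᵒ_ γ → Set
    Glues α = ∀ {n₁ n₂} {a₁ c₁ : Vec L n₁} {a₂ c₂ : Vec L n₂} {x y} →
              Separates x a₁ a₂ → Separates y c₁ c₂ →
              Sim′ _ α a₁ c₁ → Sim′ _ α a₂ c₂ → Sim′ _ α (a₁ ++ a₂) (c₁ ++ c₂)

    -- The part of e up to lead x joins a₁ and the rest joins a₂; the remaining
    -- positions are padded with x and with shiftUp x, respectively.
    forth-++ : ∀ {β} (α : Acc _<ᵒ_ β) → Glues α →
               ∀ {m n₁ n₂} {a₁ c₁ : Vec L n₁} {a₂ c₂ : Vec L n₂} {x y} →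
               Separates x a₁ a₂ → Separates y c₁ c₂ →
               Forth α m a₁ c₁ → Forth α m a₂ c₂ → Forth α m (a₁ ++ a₂) (c₁ ++ c₂)
    forth-++ α glue {m} {n₁} {n₂} {a₁} {c₁} {a₂} {c₂} {x} {y} (separates a₁<x x<a₂) (separates c₁<y y<c₂)
             forth₁ forth₂ e =
      let e₁ = leftPart x e
          e₂ = rightPart x e
          _ , separated =
            strict-separator x (a₁ ++ e₁) (a₂ ++ e₂)
              (lookup-++-all {P = λ w → lead w ≤ lead x} a₁ (<⇒≤ ∘ a₁<x) (leftPart-≤ x e))
              (lookup-++-all {P = λ w → lead x < lead w} a₂ x<a₂ (rightPart-> x e))
          d₁ , sim₁ = forth₁ e₁
          d₂ , sim₂ = forth₂ e₂
          d₁′ , alike₁ , c₁d₁′<y = squeeze-below y c₁ c₁<y d₁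
          d₂′ , alike₂ , y<c₂d₂′ = squeeze-above y c₂ y<c₂ d₂
          glued = glue {a₁ = a₁ ++ e₁} {c₁ ++ d₁′} {a₂ ++ e₂} {c₂ ++ d₂′} {y = y}
                    separated (separates c₁d₁′<y y<c₂d₂′)
                    (Sim-trans α sim₁ (Alike⇒Sim α alike₁)) (Sim-trans α sim₂ (Alike⇒Sim α alike₂))
          left? = leftOf x e
      in select left? (lookup d₁′) (lookup d₂′) ,
         Sim-reindex α {a = (a₁ ++ e₁) ++ (a₂ ++ e₂)} {(c₁ ++ d₁′) ++ (c₂ ++ d₂′)} (interleave n₁ n₂ left?)
           (lookup-interleave a₁ a₂ e₁ e₂ e left? (lookup-select-split left? e (const x) (const (shiftUp x))))
           (lookup-interleave c₁ c₂ d₁′ d₂′ _ left? (lookup-select left? (lookup d₁′) (lookup d₂′)))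
           glued

    Sim-++-separated : ∀ {γ} (α : Acc _<ᵒ_ γ) → Glues α
    Sim-++-separated (acc rs) separated separated′ sim₁ sim₂ =
      (λ γ-zero → SameAtomic-++ separated separated′ (proj₁ sim₁ γ-zero) (proj₁ sim₂ γ-zero)) ,
      λ β<γ m →
        let glue = Sim-++-separated (rs β<γ)
            forth₁ , back₁ = proj₂ sim₁ β<γ m
            forth₂ , back₂ = proj₂ sim₂ β<γ m
            swap-sides = λ {n} {a b : Vec L n} (back : ∀ d → ∃[ c ] Sim′ _ (rs β<γ) (a ++ c) (b ++ d)) →
                     map₂ (Sim-sym (rs β<γ)) ∘ back
        in forth-++ (rs β<γ) glue separated separated′ forth₁ forth₂ ,
           map₂ (Sim-sym (rs β<γ))
             ∘ forth-++ (rs β<γ) glue separated′ separated (swap-sides back₁) (swap-sides back₂)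

lemma3p16 : (S : Setting) (G : DiGraph)
    → (O : Set) (_<ᵒ_ : Rel O 0ℓ) → IsStrictTotalOrder _≡_ _<ᵒ_ → (wf : WellFounded _<ᵒ_)
    → (γ : O)
    → {n₁ n₂ : ℕ}
    → (b₁ c₁ : Vec (LG S G) (suc n₁)) (b₂ c₂ : Vec (LG S G) (suc n₂))
    → Increasing S G (b₁ ++ b₂) → Increasing S G (c₁ ++ c₂)
    → BF.Sim S G _<ᵒ_ wf γ b₁ c₁
    → BF.Sim S G _<ᵒ_ wf γ b₂ c₂
    → (∃[ x ] (len S G x ≡ 2 × _≺_ S G (last b₁) x × _≺_ S G x (head b₂)))
    → (∃[ y ] (len S G y ≡ 2 × _≺_ S G (last c₁) y × _≺_ S G y (head c₂)))
    → BF.Sim S G _<ᵒ_ wf γ (b₁ ++ b₂) (c₁ ++ c₂)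
lemma3p16 S G O _<ᵒ_ _ wf γ b₁ c₁ b₂ c₂ increasing-b increasing-c sim₁ sim₂
          (x , len-x , b₁≺x , x≺b₂) (y , len-y , c₁≺y , y≺c₂) =
  Sim-++-separated S G _<ᵒ_ (wf γ) {a₁ = b₁} {c₁} {b₂} {c₂}
    (length-2-separates S G {x = x} b₁ b₂ increasing-b len-x b₁≺x x≺b₂)
    (length-2-separates S G {x = y} c₁ c₂ increasing-c len-y c₁≺y y≺c₂)
    sim₁ sim₂
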